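{- Let $X$ and $Y$ be finite nonempty sets and let $F: X \to 2^Y$ be a set-valued mapping which admits a Hall partition $(W_1,\ldots,W_m)$. Then $F^* = F^p$, i.e. for every $i$ and every $x \in W_i$, $F^*(x) = F(x) \setminus F(W_1 \cup \cdots \cup W_{i-1})$.
   Context: A set-valued mapping $F: X \to 2^Y$ assigns to each $x$ a (possibly empty) subset $F(x) \subset Y$; $F(W) = \bigcup_{x\in W}F(x)$; $\sharp$ is cardinality. A selection of $F$ is a map $s: X \to Y$ with $s(x) \in F(x)$ for all $x$; it is alldifferent if it is injective. The alldifferent kernel $F^*: X \to 2^Y$ is $F^*(x) = \{ y \in F(x) : \text{there is an alldifferent selection } s \text{ of } F \text{ with } s(x) = y\}$. For $W \subset X$, $F_W: X\setminus W \to 2^Y$ is $F_W(x) = F(x) \setminus F(W)$. For any set-valued $G$ on a finite set, a subset $W$ of its domain is critical for $G$ if $W\ne\emptyset$ and $\sharp G(W)=\sharp W$, and non-reducible for $G$ if $W \ne\emptyset$ and no proper subset of $W$ is critical for $G$. A tuple $(W_1,\ldots,W_m)$, $m\ge1$, is a Hall partition of $F$ if the $W_i$ are nonempty, pairwise disjoint with union $X$, and with $G_i = F_{W_1\cup\cdots\cup W_{i-1}}$ ($G_1=F$): (i) $G_i(x)\neq\emptyset$ for $x \in W_i$, all $i$; (ii) $W_i$ is non-reducible for $G_i$, all $i$; (iii) $W_i$ is critical for $G_i$ for $i \le m-1$. Given a Hall partition, $F^p: X \to 2^Y$ is defined by $F^p(x) = G_i(x)$ for $x \in W_i$. -}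

module Defs where

open import Data.Nat using (ℕ; suc; _<?_)
open import Data.Fin using (Fin; toℕ; fromℕ)
open import Data.Fin.Subset using (Subset; _∈_; _⊂_; _─_; _∩_; ⋃; ∣_∣; Nonempty; Empty)
open import Data.Fin.Subset.Properties using (_∈?_)
open import Data.List using (List; map; filter; tabulate)
open import Data.Product using (_×_; ∃)
open import Function.Definitions using (Injective)
open import Relation.Binary.PropositionalEquality using (_≡_; _≢_)
open import Relation.Nullary using (¬_)

allFin : (n : ℕ) → List (Fin n)
allFin n = tabulate (λ i → i)

-- A set-valued map X → 2^Y with X = Fin n, Y = Fin k.
SetMap : ℕ → ℕ → Set
SetMap n k = Fin n → Subset k

image : ∀ {n k} → SetMap n k → Subset n → Subset k
image {n} F W = ⋃ (map F (filter (_∈? W) (allFin n)))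

IsSelection : ∀ {n k} → SetMap n k → (Fin n → Fin k) → Set
IsSelection F s = ∀ x → s x ∈ F x

IsAlldifferentSelection : ∀ {n k} → SetMap n k → (Fin n → Fin k) → Set
IsAlldifferentSelection F s = IsSelection F s × Injective _≡_ _≡_ s

-- y ∈ F*(x)  (the alldifferent kernel, as a membership relation)
InKernel : ∀ {n k} → SetMap n k → Fin n → Fin k → Set
InKernel F x y = y ∈ F x × ∃ λ s → IsAlldifferentSelection F s × s x ≡ y

-- F_U(x) = F(x) \ F(U)  (used on the domain X \ U)
restrict : ∀ {n k} → SetMap n k → Subset n → SetMap n k
restrict F U x = F x ─ image F U

-- W critical for G: W ≠ ∅ and ♯G(W) = ♯W
-- (W is always taken inside the domain of G by the users below)
Critical : ∀ {n k} → SetMap n k → Subset n → Set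
Critical G W = Nonempty W × ∣ image G W ∣ ≡ ∣ W ∣

NonReducible : ∀ {n k} → SetMap n k → Subset n → Set
NonReducible G W = Nonempty W × (∀ V → V ⊂ W → ¬ Critical G V)

-- W₁ ∪ ⋯ ∪ W_{i-1} for a family indexed by Fin m (0-based: indices j < i)
prefix : ∀ {n m} → (Fin m → Subset n) → Fin m → Subset n
prefix {n} {m} Ws i = ⋃ (map Ws (filter (λ j → toℕ j <? toℕ i) (allFin m)))

Gᵢ : ∀ {n k m} → SetMap n k → (Fin m → Subset n) → Fin m → SetMap n k
Gᵢ F Ws i = restrict F (prefix Ws i)

-- (W_1, …, W_m), m = suc m' ≥ 1, indexed by Fin (suc m') (0-based), is a Hall partition of F
IsHallPartition : ∀ {n k m'} → SetMap n k → (Fin (suc m') → Subset n) → Set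
IsHallPartition {n} {k} {m'} F Ws =
  (∀ i → Nonempty (Ws i)) ×
  (∀ i j → i ≢ j → Empty (Ws i ∩ Ws j)) ×
  (∀ (x : Fin n) → ∃ λ i → x ∈ Ws i) ×
  (∀ i x → x ∈ Ws i → Nonempty (Gᵢ F Ws i x)) ×
  (∀ i → NonReducible (Gᵢ F Ws i) (Ws i)) ×
  (∀ i → i ≢ fromℕ m' → Critical (Gᵢ F Ws i) (Ws i))

-- For x ∈ Wᵢ an alldifferent selection s has s x ∉ F(W₁ ∪ ⋯ ∪ Wᵢ₋₁): this set is the union of
-- the sets Gₗ(Wₗ), l < i, and by induction on the layers s maps each critical Wₗ injectively,
-- hence bijectively, onto Gₗ(Wₗ), so those values are used up inside Wₗ.
-- Conversely let y ∈ Gᵢ(x). Non-reducibility gives Wᵢ the surplus ∣V∣ < ∣Gᵢ(V)∣ on nonempty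
-- proper subsets, so Hall's condition survives deleting x from Wᵢ and y from the values; on the
-- other layers y is no value at all. Hall's theorem (by Rado's argument) then selects injectively
-- on every layer, and as the sets Gₗ(Wₗ) of distinct layers are disjoint, these glue with x ↦ y.

module Submission where

open import Defs
open import Data.Nat using (ℕ; zero; suc; _+_; _≤_; _<_; z≤n; s≤s; s≤s⁻¹; s<s⁻¹; _<?_)
open import Data.Nat.Properties
open import Data.Nat.Induction using (<-wellFounded)
open import Data.Fin using (Fin; toℕ; fromℕ) renaming (zero to fz; suc to fs; _<_ to _<ᶠ_)
import Data.Fin.Properties as Fin
open import Data.Fin.Induction using () renaming (<-wellFounded to <ᶠ-wellFounded)
open import Data.Fin.Subset
open import Data.Fin.Subset.Properties
open import Data.Fin.Subset.Induction using (⊂-wellFounded)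
open import Data.List using (map; filter) renaming ([] to []ˡ; _∷_ to _∷ˡ_)
open import Data.List.Relation.Unary.Any using () renaming (here to hereˡ; there to thereˡ)
import Data.List.Membership.Propositional as List
import Data.List.Membership.Propositional.Properties as List
open import Data.Product using (∃; ∃₂; _×_; _,_; proj₁; proj₂; map₂)
open import Data.Sum using (_⊎_; inj₁; inj₂)
open import Data.Empty using (⊥-elim)
open import Data.Vec using ([]; _∷_; here; there)
open import Function.Bundles using (_⇔_; mk⇔)
open import Function.Definitions using (Injective)
open import Induction.WellFounded using (Acc; acc)
open import Relation.Binary.Definitions using (tri<; tri≈; tri>)
open import Relation.Binary.PropositionalEquality
open import Relation.Nullary using (¬_; Dec; yes; no)
open import Relation.Nullary.Decidable using (_×-dec_)
open import Relation.Unary using (Decidable)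

private
  variable
    n k : ℕ

∈-⋃⁺ : ∀ {y : Fin n} {p} ps → p List.∈ ps → y ∈ p → y ∈ ⋃ ps
∈-⋃⁺ (q ∷ˡ ps) (hereˡ refl) y∈p = x∈p∪q⁺ (inj₁ y∈p)
∈-⋃⁺ (q ∷ˡ ps) (thereˡ p∈ps) y∈p = x∈p∪q⁺ (inj₂ (∈-⋃⁺ ps p∈ps y∈p))

∈-⋃⁻ : ∀ {y : Fin n} ps → y ∈ ⋃ ps → ∃ λ p → p List.∈ ps × y ∈ p
∈-⋃⁻ []ˡ y∈ = ⊥-elim (∉⊥ y∈)
∈-⋃⁻ (q ∷ˡ ps) y∈ with x∈p∪q⁻ q (⋃ ps) y∈
... | inj₁ y∈q = q , hereˡ refl , y∈q
... | inj₂ y∈⋃ps with ∈-⋃⁻ ps y∈⋃ps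
...   | p , p∈ps , y∈p = p , thereˡ p∈ps , y∈p

module _ {N} {P : Fin N → Set} (P? : Decidable P) (f : Fin N → Subset n) where

  ∈-⋃-filter⁺ : ∀ {x y} → P x → y ∈ f x → y ∈ ⋃ (map f (filter P? (allFin N)))
  ∈-⋃-filter⁺ {x} Px = ∈-⋃⁺ _ (List.∈-map⁺ f (List.∈-filter⁺ P? (List.∈-tabulate⁺ x) Px))

  ∈-⋃-filter⁻ : ∀ {y} → y ∈ ⋃ (map f (filter P? (allFin N))) → ∃ λ x → P x × y ∈ f x
  ∈-⋃-filter⁻ y∈ with ∈-⋃⁻ _ y∈
  ... | _ , p∈ , y∈p with List.∈-map⁻ f p∈
  ...   | x , x∈ , refl = x , proj₂ (List.∈-filter⁻ P? {xs = allFin N} x∈) , y∈p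

∈-image⁺ : ∀ {N} (G : SetMap N k) {W x y} → x ∈ W → y ∈ G x → y ∈ image G W
∈-image⁺ G {W} = ∈-⋃-filter⁺ (_∈? W) G

∈-image⁻ : ∀ {N} (G : SetMap N k) {W y} → y ∈ image G W → ∃ λ x → x ∈ W × y ∈ G x
∈-image⁻ G {W} = ∈-⋃-filter⁻ (_∈? W) G

∈-prefix⁺ : ∀ {m} (Ws : Fin m → Subset n) {i j x} → j <ᶠ i → x ∈ Ws j → x ∈ prefix Ws i
∈-prefix⁺ Ws {i} = ∈-⋃-filter⁺ (λ j → toℕ j <? toℕ i) Ws

∈-prefix⁻ : ∀ {m} (Ws : Fin m → Subset n) {i x} → x ∈ prefix Ws i → ∃ λ j → j <ᶠ i × x ∈ Ws j
∈-prefix⁻ Ws {i} = ∈-⋃-filter⁻ (λ j → toℕ j <? toℕ i) Ws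

∣p∪q∣+∣p∩q∣≡∣p∣+∣q∣ : (p q : Subset n) → ∣ p ∪ q ∣ + ∣ p ∩ q ∣ ≡ ∣ p ∣ + ∣ q ∣
∣p∪q∣+∣p∩q∣≡∣p∣+∣q∣ [] [] = refl
∣p∪q∣+∣p∩q∣≡∣p∣+∣q∣ (outside ∷ p) (outside ∷ q) = ∣p∪q∣+∣p∩q∣≡∣p∣+∣q∣ p q
∣p∪q∣+∣p∩q∣≡∣p∣+∣q∣ (outside ∷ p) (inside ∷ q) =
  trans (cong suc (∣p∪q∣+∣p∩q∣≡∣p∣+∣q∣ p q)) (sym (+-suc ∣ p ∣ ∣ q ∣))
∣p∪q∣+∣p∩q∣≡∣p∣+∣q∣ (inside ∷ p) (outside ∷ q) = cong suc (∣p∪q∣+∣p∩q∣≡∣p∣+∣q∣ p q)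
∣p∪q∣+∣p∩q∣≡∣p∣+∣q∣ (inside ∷ p) (inside ∷ q) = cong suc (begin
  ∣ p ∪ q ∣ + suc ∣ p ∩ q ∣   ≡⟨ +-suc ∣ p ∪ q ∣ ∣ p ∩ q ∣ ⟩
  suc (∣ p ∪ q ∣ + ∣ p ∩ q ∣) ≡⟨ cong suc (∣p∪q∣+∣p∩q∣≡∣p∣+∣q∣ p q) ⟩
  suc (∣ p ∣ + ∣ q ∣)         ≡⟨ +-suc ∣ p ∣ ∣ q ∣ ⟨
  ∣ p ∣ + suc ∣ q ∣           ∎)
  where open ≡-Reasoning

∣p∪q∣≤∣p∣+∣q∣ : (p q : Subset n) → ∣ p ∪ q ∣ ≤ ∣ p ∣ + ∣ q ∣
∣p∪q∣≤∣p∣+∣q∣ p q = subst (∣ p ∪ q ∣ ≤_) (∣p∪q∣+∣p∩q∣≡∣p∣+∣q∣ p q) (m≤m+n ∣ p ∪ q ∣ ∣ p ∩ q ∣)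

∪-least : ∀ {p q r : Subset n} → p ⊆ r → q ⊆ r → p ∪ q ⊆ r
∪-least {p = p} {q} p⊆r q⊆r x∈p∪q with x∈p∪q⁻ p q x∈p∪q
... | inj₁ x∈p = p⊆r x∈p
... | inj₂ x∈q = q⊆r x∈q

x∈p⇒⁅x⁆⊆p : ∀ {x : Fin n} {p} → x ∈ p → ⁅ x ⁆ ⊆ p
x∈p⇒⁅x⁆⊆p {x = x} {p} x∈p y∈⁅x⁆ = subst (_∈ p) (sym (x∈⁅y⁆⇒x≡y x y∈⁅x⁆)) x∈p

x∈p⇒suc∣p-x∣≡∣p∣ : ∀ {x : Fin n} {p} → x ∈ p → suc ∣ p - x ∣ ≡ ∣ p ∣
x∈p⇒suc∣p-x∣≡∣p∣ {x = fz} {inside ∷ p} here = cong (λ r → suc ∣ r ∣) (p─⊥≡p p)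
x∈p⇒suc∣p-x∣≡∣p∣ {x = fs x} {outside ∷ p} (there x∈p) = x∈p⇒suc∣p-x∣≡∣p∣ x∈p
x∈p⇒suc∣p-x∣≡∣p∣ {x = fs x} {inside ∷ p} (there x∈p) = cong suc (x∈p⇒suc∣p-x∣≡∣p∣ x∈p)

x∈p─q⇒x∉q : ∀ {x : Fin n} {p q} → x ∈ p ─ q → x ∉ q
x∈p─q⇒x∉q {p = inside ∷ p} {outside ∷ q} here ()
x∈p─q⇒x∉q {p = _ ∷ p} {_ ∷ q} (there x∈) (there x∈q) = x∈p─q⇒x∉q {p = p} x∈ x∈q

x∈p⇒0<∣p∣ : ∀ {x : Fin n} {p} → x ∈ p → 0 < ∣ p ∣
x∈p⇒0<∣p∣ x∈p = ≤-trans (s≤s z≤n) (x∈p⇒∣p-x∣<∣p∣ x∈p)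

Empty⇒∣p∣≡0 : {p : Subset n} → Empty p → ∣ p ∣ ≡ 0
Empty⇒∣p∣≡0 {n} p≡∅ = trans (cong ∣_∣ (Empty-unique p≡∅)) (∣⊥∣≡0 n)

0<∣p∣⇒Nonempty : (p : Subset n) → 0 < ∣ p ∣ → Nonempty p
0<∣p∣⇒Nonempty p 0<∣p∣ with nonempty? p
... | yes p≢∅ = p≢∅
... | no p≡∅ = ⊥-elim (<-irrefl (sym (Empty⇒∣p∣≡0 p≡∅)) 0<∣p∣)

∣p∣≤1⇒x∈p⇒y∈p⇒x≡y : ∀ {x y : Fin n} {p} → ∣ p ∣ ≤ 1 → x ∈ p → y ∈ p → x ≡ y
∣p∣≤1⇒x∈p⇒y∈p⇒x≡y {x = x} {y} {p} ∣p∣≤1 x∈p y∈p with x Fin.≟ y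
... | yes x≡y = x≡y
... | no x≢y = ⊥-elim (<-irrefl refl (begin-strict
  1                ≤⟨ x∈p⇒0<∣p∣ (x∈p∧x≢y⇒x∈p-y x∈p x≢y) ⟩
  ∣ p - y ∣        <⟨ x∈p⇒∣p-x∣<∣p∣ y∈p ⟩
  ∣ p ∣            ≤⟨ ∣p∣≤1 ⟩
  1                ∎))
  where open ≤-Reasoning

1<∣p∣⇒distinct : (p : Subset n) → 1 < ∣ p ∣ → ∃₂ λ x y → x ∈ p × y ∈ p × x ≢ y
1<∣p∣⇒distinct p 1<∣p∣ with 0<∣p∣⇒Nonempty p (<-trans (s≤s z≤n) 1<∣p∣)
... | x , x∈p with 0<∣p∣⇒Nonempty (p - x) (s<s⁻¹ (subst (1 <_) (sym (x∈p⇒suc∣p-x∣≡∣p∣ x∈p)) 1<∣p∣))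
...   | y , y∈p-x = x , y , x∈p , p─q⊆p p ⁅ x ⁆ y∈p-x ,
                    λ x≡y → x∉⁅y⁆⇒x≢y (x∈p─q⇒x∉q {p = p} y∈p-x) (sym x≡y)

InjectiveOn : ∀ {N} → Subset N → (Fin N → Fin k) → Set
InjectiveOn W s = ∀ {z z'} → z ∈ W → z' ∈ W → s z ≡ s z' → z ≡ z'

MapsInto : ∀ {N} → Subset N → Subset k → (Fin N → Fin k) → Set
MapsInto W C s = ∀ {z} → z ∈ W → s z ∈ C

injectiveOn⇒∣W∣≤∣C∣ : ∀ {N} {W : Subset N} {C : Subset k} {s} →
  InjectiveOn W s → MapsInto W C s → ∣ W ∣ ≤ ∣ C ∣
injectiveOn⇒∣W∣≤∣C∣ {W = []} _ _ = z≤n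
injectiveOn⇒∣W∣≤∣C∣ {W = outside ∷ W} inj into =
  injectiveOn⇒∣W∣≤∣C∣ {W = W} (λ z∈ z'∈ e → Fin.suc-injective (inj (there z∈) (there z'∈) e))
                             (λ z∈ → into (there z∈))
injectiveOn⇒∣W∣≤∣C∣ {W = inside ∷ W} {C} {s} inj into =
  subst (suc ∣ W ∣ ≤_) (x∈p⇒suc∣p-x∣≡∣p∣ (into here)) (s≤s (injectiveOn⇒∣W∣≤∣C∣ {W = W}
    (λ z∈ z'∈ e → Fin.suc-injective (inj (there z∈) (there z'∈) e))
    (λ z∈ → x∈p∧x≢y⇒x∈p-y (into (there z∈)) (λ e → Fin.0≢1+n (sym (inj (there z∈) here e))))))

injectiveOn∧∣C∣≤∣W∣⇒onto : ∀ {N} {W : Subset N} {C : Subset k} {s} →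
  InjectiveOn W s → MapsInto W C s → ∣ C ∣ ≤ ∣ W ∣ →
  ∀ {u} → u ∈ C → ∃ λ z → z ∈ W × s z ≡ u
injectiveOn∧∣C∣≤∣W∣⇒onto {W = W} {C} {s} inj into ∣C∣≤∣W∣ {u} u∈C
  with Fin.any? (λ z → (z ∈? W) ×-dec (s z Fin.≟ u))
... | yes hit = hit
... | no miss = ⊥-elim (<-irrefl refl (begin-strict
  ∣ W ∣     ≤⟨ injectiveOn⇒∣W∣≤∣C∣ inj
                 (λ {z} z∈W → x∈p∧x≢y⇒x∈p-y (into z∈W) (λ e → miss (z , z∈W , e))) ⟩
  ∣ C - u ∣ <⟨ x∈p⇒∣p-x∣<∣p∣ u∈C ⟩
  ∣ C ∣     ≤⟨ ∣C∣≤∣W∣ ⟩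
  ∣ W ∣     ∎))
  where open ≤-Reasoning

image-mono : ∀ {N} {G H : SetMap N k} {V W} → V ⊆ W → (∀ {w} → w ∈ V → G w ⊆ H w) →
  image G V ⊆ image H W
image-mono {G = G} {H} V⊆W G⊆H u∈ with ∈-image⁻ G u∈
... | w , w∈V , u∈Gw = ∈-image⁺ H (V⊆W w∈V) (G⊆H w∈V u∈Gw)

HallCondition : ∀ {N} → SetMap N k → Subset N → Set
HallCondition G D = ∀ V → V ⊆ D → ∣ V ∣ ≤ ∣ image G V ∣

Deficient : ∀ {N} → SetMap N k → Subset N → Set
Deficient G V = ∣ image G V ∣ < ∣ V ∣

InjectiveSelectionOn : ∀ {N} → SetMap N k → Subset N → (Fin N → Fin k) → Set
InjectiveSelectionOn G D t = (∀ {z} → z ∈ D → t z ∈ G z) × InjectiveOn D t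

deficientSubset? : ∀ {N} (G : SetMap N k) D → Dec (∃ λ V → V ⊆ D × Deficient G V)
deficientSubset? G D = anySubset? (λ V → (V ⊆? D) ×-dec (∣ image G V ∣ <? ∣ V ∣))

noDeficientSubset⇒hall : ∀ {N} {G : SetMap N k} {D} →
  ¬ (∃ λ V → V ⊆ D × Deficient G V) → HallCondition G D
noDeficientSubset⇒hall none V V⊆D = ≮⇒≥ (λ deficient → none (V , V⊆D , deficient))

hall⇒nonempty : ∀ {N} {G : SetMap N k} {D z} → HallCondition G D → z ∈ D → Nonempty (G z)
hall⇒nonempty {G = G} {D} {z} hallG z∈D with 0<∣p∣⇒Nonempty (image G ⁅ z ⁆)
  (subst (_≤ ∣ image G ⁅ z ⁆ ∣) (∣⁅x⁆∣≡1 z) (hallG ⁅ z ⁆ (x∈p⇒⁅x⁆⊆p z∈D)))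
... | u , u∈ with ∈-image⁻ G u∈
...   | w , w∈⁅z⁆ , u∈Gw = u , subst (λ v → u ∈ G v) (x∈⁅y⁆⇒x≡y z w∈⁅z⁆) u∈Gw

removeAt : ∀ {N} → SetMap N k → Fin N → Fin k → SetMap N k
removeAt G z y w with w Fin.≟ z
... | yes _ = G w - y
... | no _ = G w

removeAt-⊆ : ∀ {N} (G : SetMap N k) z y w → removeAt G z y w ⊆ G w
removeAt-⊆ G z y w with w Fin.≟ z
... | yes _ = p─q⊆p (G w) ⁅ y ⁆
... | no _ = λ u∈ → u∈

∈-removeAt⁺ : ∀ {N} (G : SetMap N k) {z y w u} → u ∈ G w → w ≢ z ⊎ u ≢ y →
  u ∈ removeAt G z y w
∈-removeAt⁺ G {z} {y} {w} u∈Gw kept with w Fin.≟ z | kept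
... | yes w≡z | inj₁ w≢z = ⊥-elim (w≢z w≡z)
... | yes _ | inj₂ u≢y = x∈p∧x≢y⇒x∈p-y u∈Gw u≢y
... | no _ | _ = u∈Gw

removeAt-self : ∀ {N} (G : SetMap N k) z y → removeAt G z y z ≡ G z - y
removeAt-self G z y with z Fin.≟ z
... | yes _ = refl
... | no z≢z = ⊥-elim (z≢z refl)

∑ : ∀ {N} → (Fin N → ℕ) → ℕ
∑ {zero} f = 0
∑ {suc N} f = f fz + ∑ (λ w → f (fs w))

∑-mono-≤ : ∀ {N} {f g : Fin N → ℕ} → (∀ w → f w ≤ g w) → ∑ f ≤ ∑ g
∑-mono-≤ {zero} f≤g = z≤n
∑-mono-≤ {suc N} f≤g = +-mono-≤ (f≤g fz) (∑-mono-≤ (λ w → f≤g (fs w)))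

∑-mono-< : ∀ {N} {f g : Fin N → ℕ} z → (∀ w → f w ≤ g w) → f z < g z → ∑ f < ∑ g
∑-mono-< fz f≤g fz<gz = +-mono-<-≤ fz<gz (∑-mono-≤ (λ w → f≤g (fs w)))
∑-mono-< (fs z) f≤g fz<gz = +-mono-≤-< (f≤g fz) (∑-mono-< z (λ w → f≤g (fs w)) fz<gz)

weight : ∀ {N} → SetMap N k → ℕ
weight G = ∑ (λ w → ∣ G w ∣)

weight-removeAt< : ∀ {N} (G : SetMap N k) {z y} → y ∈ G z → weight (removeAt G z y) < weight G
weight-removeAt< G {z} {y} y∈Gz = ∑-mono-< z (λ w → p⊆q⇒∣p∣≤∣q∣ (removeAt-⊆ G z y w))
  (subst (λ p → ∣ p ∣ < ∣ G z ∣) (sym (removeAt-self G z y)) (x∈p⇒∣p-x∣<∣p∣ y∈Gz))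

-- Removing a value at z leaves the images of sets avoiding z unchanged.
deficient-removeAt⇒∋ : ∀ {N} {G : SetMap N k} {D A z y} → HallCondition G D → A ⊆ D →
  Deficient (removeAt G z y) A → z ∈ A
deficient-removeAt⇒∋ {G = G} {A = A} {z} {y} hallG A⊆D deficient with z ∈? A
... | yes z∈A = z∈A
... | no z∉A = ⊥-elim (<⇒≱ deficient (≤-trans (hallG A A⊆D) (p⊆q⇒∣p∣≤∣q∣
        (image-mono (λ w∈A → w∈A) λ {w} w∈A u∈Gw →
          ∈-removeAt⁺ G u∈Gw (inj₁ (λ w≡z → z∉A (subst (_∈ A) w≡z w∈A)))))))

-- With P, Q the reduced images of A, B and C = (A ∩ B) - z one has
-- G(A ∪ B) ⊆ P ∪ Q and G(C) ⊆ P ∩ Q, so Hall's condition and inclusion–exclusion give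
-- ∣A∣ + ∣B∣ ≤ ∣P∣ + ∣Q∣ + 1, while the two deficiencies give ∣A∣ + ∣B∣ ≥ ∣P∣ + ∣Q∣ + 2.
removeAt-¬bothDeficient : ∀ {N} {G : SetMap N k} {D A B z y₁ y₂} → HallCondition G D → y₁ ≢ y₂ →
  A ⊆ D → B ⊆ D → ¬ (Deficient (removeAt G z y₁) A × Deficient (removeAt G z y₂) B)
removeAt-¬bothDeficient {G = G} {D} {A} {B} {z} {y₁} {y₂} hallG y₁≢y₂ A⊆D B⊆D (defA , defB) =
  <-irrefl refl (begin-strict
    ∣ A ∣ + ∣ B ∣               ≡⟨ ∣p∪q∣+∣p∩q∣≡∣p∣+∣q∣ A B ⟨
    ∣ A ∪ B ∣ + ∣ A ∩ B ∣       ≡⟨ cong (∣ A ∪ B ∣ +_) (x∈p⇒suc∣p-x∣≡∣p∣ z∈A∩B) ⟨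
    ∣ A ∪ B ∣ + suc ∣ C ∣       ≤⟨ +-mono-≤ ∣A∪B∣≤∣P∪Q∣ (s≤s ∣C∣≤∣P∩Q∣) ⟩
    ∣ P ∪ Q ∣ + suc ∣ P ∩ Q ∣   ≡⟨ +-suc ∣ P ∪ Q ∣ ∣ P ∩ Q ∣ ⟩
    suc (∣ P ∪ Q ∣ + ∣ P ∩ Q ∣) ≡⟨ cong suc (∣p∪q∣+∣p∩q∣≡∣p∣+∣q∣ P Q) ⟩
    suc (∣ P ∣ + ∣ Q ∣)         <⟨ s≤s (≤-reflexive (sym (+-suc ∣ P ∣ ∣ Q ∣))) ⟩
    suc ∣ P ∣ + suc ∣ Q ∣       ≤⟨ +-mono-≤ defA defB ⟩
    ∣ A ∣ + ∣ B ∣               ∎)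
  where
  open ≤-Reasoning
  G₁ G₂ : SetMap _ _
  G₁ = removeAt G z y₁
  G₂ = removeAt G z y₂
  P Q C : Subset _
  P = image G₁ A
  Q = image G₂ B
  C = (A ∩ B) - z

  z∈A : z ∈ A
  z∈A = deficient-removeAt⇒∋ hallG A⊆D defA
  z∈B : z ∈ B
  z∈B = deficient-removeAt⇒∋ hallG B⊆D defB
  z∈A∩B : z ∈ A ∩ B
  z∈A∩B = x∈p∩q⁺ (z∈A , z∈B)

  C⊆D : C ⊆ D
  C⊆D w∈C = A⊆D (p∩q⊆p A B (p─q⊆p (A ∩ B) ⁅ z ⁆ w∈C))

  image-A∪B⊆P∪Q : image G (A ∪ B) ⊆ P ∪ Q
  image-A∪B⊆P∪Q {u} u∈ with ∈-image⁻ G u∈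
  ... | w , w∈A∪B , u∈Gw with w Fin.≟ z | u Fin.≟ y₁
  ... | yes refl | yes refl = x∈p∪q⁺ (inj₂ (∈-image⁺ G₂ z∈B (∈-removeAt⁺ G u∈Gw (inj₂ y₁≢y₂))))
  ... | yes refl | no u≢y₁ = x∈p∪q⁺ (inj₁ (∈-image⁺ G₁ z∈A (∈-removeAt⁺ G u∈Gw (inj₂ u≢y₁))))
  ... | no w≢z | _ with x∈p∪q⁻ A B w∈A∪B
  ...   | inj₁ w∈A = x∈p∪q⁺ (inj₁ (∈-image⁺ G₁ w∈A (∈-removeAt⁺ G u∈Gw (inj₁ w≢z))))
  ...   | inj₂ w∈B = x∈p∪q⁺ (inj₂ (∈-image⁺ G₂ w∈B (∈-removeAt⁺ G u∈Gw (inj₁ w≢z))))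

  ∣A∪B∣≤∣P∪Q∣ : ∣ A ∪ B ∣ ≤ ∣ P ∪ Q ∣
  ∣A∪B∣≤∣P∪Q∣ = ≤-trans (hallG (A ∪ B) (∪-least A⊆D B⊆D)) (p⊆q⇒∣p∣≤∣q∣ image-A∪B⊆P∪Q)

  image-C⊆P∩Q : image G C ⊆ P ∩ Q
  image-C⊆P∩Q u∈ with ∈-image⁻ G u∈
  ... | w , w∈C , u∈Gw with x∈p∩q⁻ A B (p─q⊆p (A ∩ B) ⁅ z ⁆ w∈C)
  ...   | w∈A , w∈B = x∈p∩q⁺ ( ∈-image⁺ G₁ w∈A (∈-removeAt⁺ G u∈Gw (inj₁ w≢z))
                               , ∈-image⁺ G₂ w∈B (∈-removeAt⁺ G u∈Gw (inj₁ w≢z)))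
    where
    w≢z : w ≢ z
    w≢z = x∉⁅y⁆⇒x≢y (x∈p─q⇒x∉q {p = A ∩ B} w∈C)

  ∣C∣≤∣P∩Q∣ : ∣ C ∣ ≤ ∣ P ∩ Q ∣
  ∣C∣≤∣P∩Q∣ = ≤-trans (hallG C C⊆D) (p⊆q⇒∣p∣≤∣q∣ image-C⊆P∩Q)

rado : ∀ {N} {G : SetMap N k} {D z y₁ y₂} → HallCondition G D → y₁ ≢ y₂ →
  HallCondition (removeAt G z y₁) D ⊎ HallCondition (removeAt G z y₂) D
rado {G = G} {D} {z} {y₁} {y₂} hallG y₁≢y₂
  with deficientSubset? (removeAt G z y₁) D | deficientSubset? (removeAt G z y₂) D
... | no none₁ | _ = inj₁ (noDeficientSubset⇒hall none₁)
... | yes _ | no none₂ = inj₂ (noDeficientSubset⇒hall none₂)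
... | yes (A , A⊆D , defA) | yes (B , B⊆D , defB) =
  ⊥-elim (removeAt-¬bothDeficient hallG y₁≢y₂ A⊆D B⊆D (defA , defB))

pick : Subset (suc k) → Fin (suc k)
pick p with nonempty? p
... | yes (y , _) = y
... | no _ = fz

pick-∈ : {p : Subset (suc k)} → Nonempty p → pick p ∈ p
pick-∈ {p = p} p≢∅ with nonempty? p
... | yes (_ , y∈p) = y∈p
... | no p≡∅ = ⊥-elim (p≡∅ p≢∅)

hall-≤1 : ∀ {N} {G : SetMap N (suc k)} {D} → HallCondition G D → (∀ {z} → z ∈ D → ∣ G z ∣ ≤ 1) →
  InjectiveSelectionOn G D (λ z → pick (G z))
hall-≤1 {G = G} {D} hallG ≤1 = pick∈ , injective
  where
  pick∈ : ∀ {z} → z ∈ D → pick (G z) ∈ G z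
  pick∈ z∈D = pick-∈ (hall⇒nonempty hallG z∈D)

  ≡pick : ∀ {z u} → z ∈ D → u ∈ G z → u ≡ pick (G z)
  ≡pick z∈D u∈Gz = ∣p∣≤1⇒x∈p⇒y∈p⇒x≡y (≤1 z∈D) u∈Gz (pick∈ z∈D)

  injective : InjectiveOn D (λ z → pick (G z))
  injective {z} {z'} z∈D z'∈D same =
    ∣p∣≤1⇒x∈p⇒y∈p⇒x≡y ∣V∣≤1 (x∈p∪q⁺ (inj₁ (x∈⁅x⁆ z))) (x∈p∪q⁺ (inj₂ (x∈⁅x⁆ z')))
    where
    V : Subset _
    V = ⁅ z ⁆ ∪ ⁅ z' ⁆

    image⊆⁅pick⁆ : image G V ⊆ ⁅ pick (G z) ⁆
    image⊆⁅pick⁆ {u} u∈ with ∈-image⁻ G u∈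
    ... | w , w∈V , u∈Gw with x∈p∪q⁻ ⁅ z ⁆ ⁅ z' ⁆ w∈V
    ...   | inj₁ w∈⁅z⁆ rewrite x∈⁅y⁆⇒x≡y z w∈⁅z⁆ =
      subst (_∈ ⁅ pick (G z) ⁆) (sym (≡pick z∈D u∈Gw)) (x∈⁅x⁆ _)
    ...   | inj₂ w∈⁅z'⁆ rewrite x∈⁅y⁆⇒x≡y z' w∈⁅z'⁆ =
      subst (_∈ ⁅ pick (G z) ⁆) (sym (trans (≡pick z'∈D u∈Gw) (sym same))) (x∈⁅x⁆ _)

    ∣V∣≤1 : ∣ V ∣ ≤ 1
    ∣V∣≤1 = ≤-trans (hallG V (∪-least (x∈p⇒⁅x⁆⊆p z∈D) (x∈p⇒⁅x⁆⊆p z'∈D)))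
                    (subst (∣ image G V ∣ ≤_) (∣⁅x⁆∣≡1 (pick (G z))) (p⊆q⇒∣p∣≤∣q∣ image⊆⁅pick⁆))

injectiveSelectionOn-⊆ : ∀ {N} {G H : SetMap N k} {D t} → (∀ {w} → H w ⊆ G w) →
  InjectiveSelectionOn H D t → InjectiveSelectionOn G D t
injectiveSelectionOn-⊆ H⊆G (selects , injective) = (λ w∈D → H⊆G (selects w∈D)) , injective

hall-acc : ∀ {N} (G : SetMap N (suc k)) {D} → Acc _<_ (weight G) → HallCondition G D →
  ∃ (InjectiveSelectionOn G D)
hall-acc G {D} (acc smaller) hallG with Fin.any? (λ z → (z ∈? D) ×-dec (1 <? ∣ G z ∣))
... | no none = _ , hall-≤1 hallG (λ {z} z∈D → ≮⇒≥ (λ 1<∣Gz∣ → none (z , z∈D , 1<∣Gz∣)))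
... | yes (z , _ , 1<∣Gz∣) with 1<∣p∣⇒distinct (G z) 1<∣Gz∣
...   | y₁ , y₂ , y₁∈Gz , y₂∈Gz , y₁≢y₂ with rado {z = z} hallG y₁≢y₂
...     | inj₁ hall₁ = map₂ (injectiveSelectionOn-⊆ (removeAt-⊆ G z y₁ _))
                          (hall-acc _ (smaller (weight-removeAt< G y₁∈Gz)) hall₁)
...     | inj₂ hall₂ = map₂ (injectiveSelectionOn-⊆ (removeAt-⊆ G z y₂ _))
                          (hall-acc _ (smaller (weight-removeAt< G y₂∈Gz)) hall₂)

hall : ∀ {N} {G : SetMap N (suc k)} {D} → HallCondition G D → ∃ (InjectiveSelectionOn G D)
hall {G = G} = hall-acc G (<-wellFounded (weight G))

module _ {m} (F : SetMap n k) (Ws : Fin m → Subset n) where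

  Gᵢ⊆F : ∀ j z → Gᵢ F Ws j z ⊆ F z
  Gᵢ⊆F j z = p─q⊆p (F z) (image F (prefix Ws j))

  image-prefix⇒∈layer : ∀ {j u} → Acc _<ᶠ_ j → u ∈ image F (prefix Ws j) →
    ∃ λ l → l <ᶠ j × u ∈ image (Gᵢ F Ws l) (Ws l)
  image-prefix⇒∈layer {u = u} (acc smaller) u∈ with ∈-image⁻ F u∈
  ... | w , w∈prefix , u∈Fw with ∈-prefix⁻ Ws w∈prefix
  ...   | l , l<j , w∈Wl with u ∈? image F (prefix Ws l)
  ...     | no u∉ = l , l<j , ∈-image⁺ (Gᵢ F Ws l) w∈Wl (x∈p∧x∉q⇒x∈p─q u∈Fw u∉)
  ...     | yes u∈' with image-prefix⇒∈layer (smaller l<j) u∈'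
  ...       | l' , l'<l , u∈Gl' = l' , <-trans l'<l l<j , u∈Gl'

  Gᵢ-disjoint-< : ∀ {j l z z' w} → l <ᶠ j → z ∈ Ws l → w ∈ F z → w ∉ Gᵢ F Ws j z'
  Gᵢ-disjoint-< l<j z∈Wl w∈Fz w∈Gjz' =
    x∈p─q⇒x∉q {p = F _} w∈Gjz' (∈-image⁺ F (∈-prefix⁺ Ws l<j z∈Wl) w∈Fz)

  Gᵢ-disjoint : ∀ {j l z z' w} → j ≢ l → z ∈ Ws j → z' ∈ Ws l →
    w ∈ Gᵢ F Ws j z → w ∉ Gᵢ F Ws l z'
  Gᵢ-disjoint {j} {l} j≢l z∈Wj z'∈Wl w∈Gjz w∈Glz' with Fin.<-cmp j l
  ... | tri< j<l _ _ = Gᵢ-disjoint-< j<l z∈Wj (Gᵢ⊆F j _ w∈Gjz) w∈Glz'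
  ... | tri≈ _ j≡l _ = j≢l j≡l
  ... | tri> _ _ l<j = Gᵢ-disjoint-< l<j z'∈Wl (Gᵢ⊆F l _ w∈Glz') w∈Gjz

module _ {N} {G : SetMap N k} {W : Subset N}
         (nonempty : ∀ {z} → z ∈ W → Nonempty (G z)) (nonReducible : NonReducible G W) where

  private
    noncritical-< : ∀ {V} → V ⊂ W → Nonempty V → ∣ V ∣ ≤ ∣ image G V ∣ → ∣ V ∣ < ∣ image G V ∣
    noncritical-< V⊂W V≢∅ ∣V∣≤ = ≤∧≢⇒< ∣V∣≤ (λ ∣V∣≡ → proj₂ nonReducible _ V⊂W (V≢∅ , sym ∣V∣≡))

    hall-⊂-acc : ∀ {V} → Acc _⊂_ V → V ⊆ W → ∣ V ∣ ≤ ∣ image G V ∣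
    hall-⊂-acc {V} (acc smaller) V⊆W with nonempty? V
    ... | no V≡∅ = subst (_≤ ∣ image G V ∣) (sym (Empty⇒∣p∣≡0 V≡∅)) z≤n
    ... | yes (x , x∈V) = subst (_≤ ∣ image G V ∣) (x∈p⇒suc∣p-x∣≡∣p∣ x∈V) ∣V-x∣<∣GV∣
      where
      V-x⊂V : V - x ⊂ V
      V-x⊂V = x∈p⇒p-x⊂p x∈V

      ∣V-x∣<∣GV∣ : ∣ V - x ∣ < ∣ image G V ∣
      ∣V-x∣<∣GV∣ with nonempty? (V - x)
      ... | yes V-x≢∅ = <-≤-trans
              (noncritical-< (⊂-⊆-trans V-x⊂V V⊆W) V-x≢∅
                (hall-⊂-acc (smaller V-x⊂V) (⊆-trans (p─q⊆p V ⁅ x ⁆) V⊆W)))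
              (p⊆q⇒∣p∣≤∣q∣ (image-mono (p─q⊆p V ⁅ x ⁆) (λ _ u∈ → u∈)))
      ... | no V-x≡∅ with nonempty (V⊆W x∈V)
      ...   | y , y∈Gx = subst (_< ∣ image G V ∣) (sym (Empty⇒∣p∣≡0 V-x≡∅))
                           (x∈p⇒0<∣p∣ (∈-image⁺ G x∈V y∈Gx))

  nonReducible⇒hall : HallCondition G W
  nonReducible⇒hall V = hall-⊂-acc (⊂-wellFounded V)

  nonReducible⇒surplus : ∀ {V} → V ⊂ W → Nonempty V → ∣ V ∣ < ∣ image G V ∣
  nonReducible⇒surplus V⊂W V≢∅ = noncritical-< V⊂W V≢∅ (nonReducible⇒hall _ (p⊂q⇒p⊆q V⊂W))

removeValue : ∀ {N} → SetMap N k → Fin k → SetMap N k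
removeValue G y z = G z - y

hall-removeValue-absent : ∀ {N} {G : SetMap N k} {W y} → HallCondition G W →
  (∀ {z} → z ∈ W → y ∉ G z) → HallCondition (removeValue G y) W
hall-removeValue-absent {G = G} hallG y∉ V V⊆W = ≤-trans (hallG V V⊆W) (p⊆q⇒∣p∣≤∣q∣
  (image-mono (λ w∈V → w∈V) (λ {w} w∈V u∈Gw →
    x∈p∧x≢y⇒x∈p-y u∈Gw (λ u≡y → y∉ (V⊆W w∈V) (subst (_∈ G w) u≡y u∈Gw)))))

-- Removing one value costs each image at most one element, which the surplus absorbs.
surplus⇒hall-removeValue : ∀ {N} {G : SetMap N k} {W x y} →
  (∀ {V} → V ⊂ W → Nonempty V → ∣ V ∣ < ∣ image G V ∣) → x ∈ W →
  HallCondition (removeValue G y) (W - x)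
surplus⇒hall-removeValue {G = G} {W} {x} {y} surplus x∈W V V⊆W-x with nonempty? V
... | no V≡∅ = subst (_≤ ∣ image (removeValue G y) V ∣) (sym (Empty⇒∣p∣≡0 V≡∅)) z≤n
... | yes V≢∅ = s≤s⁻¹ (begin
  suc ∣ V ∣                               ≤⟨ surplus (⊆-⊂-trans V⊆W-x (x∈p⇒p-x⊂p x∈W)) V≢∅ ⟩
  ∣ image G V ∣                           ≤⟨ p⊆q⇒∣p∣≤∣q∣ image⊆ ⟩
  ∣ image (removeValue G y) V ∪ ⁅ y ⁆ ∣   ≤⟨ ∣p∪q∣≤∣p∣+∣q∣ (image (removeValue G y) V) ⁅ y ⁆ ⟩
  ∣ image (removeValue G y) V ∣ + ∣ ⁅ y ⁆ ∣ ≡⟨ cong (∣ image (removeValue G y) V ∣ +_) (∣⁅x⁆∣≡1 y) ⟩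
  ∣ image (removeValue G y) V ∣ + 1       ≡⟨ +-comm _ 1 ⟩
  suc ∣ image (removeValue G y) V ∣       ∎)
  where
  open ≤-Reasoning
  image⊆ : image G V ⊆ image (removeValue G y) V ∪ ⁅ y ⁆
  image⊆ {u} u∈ with ∈-image⁻ G u∈ | u Fin.≟ y
  ... | _ , _ , _ | yes refl = x∈p∪q⁺ (inj₂ (x∈⁅x⁆ u))
  ... | w , w∈V , u∈Gw | no u≢y =
    x∈p∪q⁺ (inj₁ (∈-image⁺ (removeValue G y) w∈V (x∈p∧x≢y⇒x∈p-y u∈Gw u≢y)))

<ᶠ⇒≢fromℕ : ∀ {m} {l j : Fin (suc m)} → l <ᶠ j → l ≢ fromℕ m
<ᶠ⇒≢fromℕ {j = j} l<j refl = <⇒≱ l<j (Fin.≤fromℕ j)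

module _ {m'} {F : SetMap n (suc k)} {Ws : Fin (suc m') → Subset n} (hp : IsHallPartition F Ws) where

  private
    G : Fin (suc m') → SetMap n (suc k)
    G = Gᵢ F Ws

    disjoint : ∀ {j l z} → j ≢ l → z ∈ Ws j → z ∉ Ws l
    disjoint j≢l z∈Wj z∈Wl = proj₁ (proj₂ hp) _ _ j≢l (_ , x∈p∩q⁺ (z∈Wj , z∈Wl))

    layer : Fin n → Fin (suc m')
    layer z = proj₁ (proj₁ (proj₂ (proj₂ hp)) z)

    ∈layer : ∀ z → z ∈ Ws (layer z)
    ∈layer z = proj₂ (proj₁ (proj₂ (proj₂ hp)) z)

    nonemptyValues : ∀ {j z} → z ∈ Ws j → Nonempty (G j z)
    nonemptyValues = proj₁ (proj₂ (proj₂ (proj₂ hp))) _ _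

    nonReducible : ∀ j → NonReducible (G j) (Ws j)
    nonReducible = proj₁ (proj₂ (proj₂ (proj₂ (proj₂ hp))))

    critical : ∀ {j} → j ≢ fromℕ m' → ∣ image (G j) (Ws j) ∣ ≡ ∣ Ws j ∣
    critical j≢last = proj₂ (proj₂ (proj₂ (proj₂ (proj₂ (proj₂ hp)))) _ j≢last)

  -- On an earlier, hence non-last, layer l the selection maps Wₗ injectively into the critical
  -- set Gₗ(Wₗ), hence onto it: every value in Gₗ(Wₗ) is already used inside Wₗ.
  alldifferent⇒∈Gᵢ : ∀ {s} → IsAlldifferentSelection F s →
    ∀ {j} → Acc _<ᶠ_ j → ∀ {z} → z ∈ Ws j → s z ∈ G j z
  alldifferent⇒∈Gᵢ {s} alldiff@(selects , injective) {j} (acc smaller) {z} z∈Wj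
    with s z ∈? image F (prefix Ws j)
  ... | no sz∉ = x∈p∧x∉q⇒x∈p─q (selects z) sz∉
  ... | yes sz∈ with image-prefix⇒∈layer F Ws (<ᶠ-wellFounded j) sz∈
  ...   | l , l<j , sz∈GlWl
          with injectiveOn∧∣C∣≤∣W∣⇒onto (λ _ _ → injective)
                 (λ z'∈Wl → ∈-image⁺ (G l) z'∈Wl (alldifferent⇒∈Gᵢ alldiff (smaller l<j) z'∈Wl))
                 (≤-reflexive (critical (<ᶠ⇒≢fromℕ l<j))) sz∈GlWl
  ...     | z' , z'∈Wl , sz'≡sz =
              ⊥-elim (disjoint (Fin.<⇒≢ l<j) (subst (_∈ Ws l) (injective sz'≡sz) z'∈Wl) z∈Wj)

  kernel⊆peeled : ∀ {i x y} → x ∈ Ws i → InKernel F x y → y ∈ G i x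
  kernel⊆peeled {i} x∈Wi (_ , s , alldiff , refl) = alldifferent⇒∈Gᵢ alldiff (<ᶠ-wellFounded i) x∈Wi

  module _ {i x y} (x∈Wi : x ∈ Ws i) (y∈Gix : y ∈ G i x) where

    private
      layerHall : ∀ j → HallCondition (removeValue (G j) y) (Ws j - x)
      layerHall j with j Fin.≟ i
      ... | yes refl = surplus⇒hall-removeValue
                         (nonReducible⇒surplus nonemptyValues (nonReducible j)) x∈Wi
      ... | no j≢i = λ V V⊆Wj-x → hall-removeValue-absent
              (nonReducible⇒hall nonemptyValues (nonReducible j))
              (λ z∈Wj y∈Gjz → Gᵢ-disjoint F Ws j≢i z∈Wj x∈Wi y∈Gjz y∈Gix)
              V (⊆-trans V⊆Wj-x (p─q⊆p (Ws j) ⁅ x ⁆))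

      t : Fin (suc m') → Fin n → Fin (suc k)
      t j = proj₁ (hall (layerHall j))

      t-selects : ∀ {j z} → z ∈ Ws j - x → t j z ∈ G j z - y
      t-selects {j} = proj₁ (proj₂ (hall (layerHall j)))

      t-injective : ∀ {j l z z'} → z ∈ Ws j - x → z' ∈ Ws l - x → t j z ≡ t l z' → z ≡ z'
      t-injective {j} {l} z∈ z'∈ tz≡tz' with j Fin.≟ l
      ... | yes refl = proj₂ (proj₂ (hall (layerHall j))) z∈ z'∈ tz≡tz'
      ... | no j≢l = ⊥-elim (Gᵢ-disjoint F Ws j≢l (p─q⊆p (Ws j) ⁅ x ⁆ z∈) (p─q⊆p (Ws l) ⁅ x ⁆ z'∈)
                       (p─q⊆p (G j _) ⁅ y ⁆ (t-selects z∈))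
                       (subst (_∈ G l _) (sym tz≡tz') (p─q⊆p (G l _) ⁅ y ⁆ (t-selects z'∈))))

      ∈layer-x : ∀ {z} → z ≢ x → z ∈ Ws (layer z) - x
      ∈layer-x {z} z≢x = x∈p∧x≢y⇒x∈p-y (∈layer z) z≢x

      t≢y : ∀ {z} → z ≢ x → t (layer z) z ≢ y
      t≢y z≢x tz≡y = x∈p─q⇒x∉q {p = G (layer _) _} (t-selects (∈layer-x z≢x))
                       (subst (_∈ ⁅ y ⁆) (sym tz≡y) (x∈⁅x⁆ y))

      s : Fin n → Fin (suc k)
      s z with z Fin.≟ x
      ... | yes _ = y
      ... | no _ = t (layer z) z

      s-selects : IsSelection F s
      s-selects z with z Fin.≟ x
      ... | yes refl = Gᵢ⊆F F Ws i x y∈Gix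
      ... | no z≢x = Gᵢ⊆F F Ws (layer z) z (p─q⊆p (G (layer z) z) ⁅ y ⁆ (t-selects (∈layer-x z≢x)))

      s-injective : Injective _≡_ _≡_ s
      s-injective {z} {z'} sz≡sz' with z Fin.≟ x | z' Fin.≟ x
      ... | yes z≡x | yes z'≡x = trans z≡x (sym z'≡x)
      ... | yes _ | no z'≢x = ⊥-elim (t≢y z'≢x (sym sz≡sz'))
      ... | no z≢x | yes _ = ⊥-elim (t≢y z≢x sz≡sz')
      ... | no z≢x | no z'≢x = t-injective (∈layer-x z≢x) (∈layer-x z'≢x) sz≡sz'

      s-x : s x ≡ y
      s-x with x Fin.≟ x
      ... | yes _ = refl
      ... | no x≢x = ⊥-elim (x≢x refl)

    peeled⊆kernel : InKernel F x y
    peeled⊆kernel = Gᵢ⊆F F Ws i x y∈Gix , s , (s-selects , s-injective) , s-x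

theorem4p1 : ∀ {n k m' : ℕ} (F : Fin (suc n) → Subset (suc k))
    (Ws : Fin (suc m') → Subset (suc n)) →
    IsHallPartition F Ws →
    ∀ i x → x ∈ Ws i → ∀ y → (InKernel F x y ⇔ y ∈ Gᵢ F Ws i x)
theorem4p1 F Ws hp i x x∈Wi y = mk⇔ (kernel⊆peeled hp x∈Wi) (peeled⊆kernel hp x∈Wi)
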